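{- Let $(c_n)_{n\ge0}$ be a sequence of nonzero numbers with $c_0=1$, let $\omega$ be an umbra with $\omega^n\simeq n!/c_n$, and let $\gamma,\alpha$ be umbrae. Let $n\ge k\ge0$ and let $m$ be an integer with $k\ge m$. Then \[ {}_{\omega}(\gamma,\alpha)_{n,k}\simeq\frac{c_n\,c_{k-m}}{c_k}\sum_{i=0}^{n-k}\frac{1}{c_{n-m-i}}\,\frac{(m.\alpha)^{i}}{i!}\;{}_{\omega}(\gamma,\alpha)_{n-m-i,k-m}. \]
   Context: Classical umbral calculus: $R=\mathbb{C}[x]$, $A$ a saturated alphabet of umbrae, $E:R[A]\to R$ linear with $E[1]=1$ and $E[\alpha^i\beta^j\cdots]=E[\alpha^i]E[\beta^j]\cdots$ for distinct umbrae; $p\simeq q$ means $E[p]=E[q]$. $f_\alpha(t)=\sum_n E[\alpha^n]t^n/n!$. For an integer $x$ (possibly negative), $x.\alpha$ is an umbra with $(x.\alpha)^n\simeq n![t^n]f_\alpha(t)^x$. The $\omega$-Riordan array ${}_\omega(\gamma,\alpha)$ is the lower triangular matrix with entries ${}_\omega(\gamma,\alpha)_{n,k}=E\!\left[\frac{c_n}{c_k}\frac{(\gamma+k.\alpha)^{n-k}}{(n-k)!}\right]$ for $n\ge k\ge0$, where $\gamma$ and $k.\alpha$ are uncorrelated. -}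

module Defs where

open import Level using (Level; _⊔_)
open import Data.Nat using (ℕ; zero; suc; _∸_; _!)
open import Data.Nat.Combinatorics using (_C_)
open import Data.Integer using (ℤ; +_; -[1+_])
open import Relation.Nullary using (¬_)
open import Algebra.Bundles using (CommutativeRing)

-- A field (the paper works over ℂ): a commutative ring with
-- a total inverse map with x * x⁻¹ ≈ 1 for x ≉ 0, and characteristic 0.
-- embedding of ℕ into a commutative ring
ofℕ : ∀ {c ℓ} (R : CommutativeRing c ℓ) → ℕ → CommutativeRing.Carrier R
ofℕ R zero    = CommutativeRing.0# R
ofℕ R (suc n) = CommutativeRing._+_ R (CommutativeRing.1# R) (ofℕ R n)

record Field (c ℓ : Level) : Set (Level.suc (c ⊔ ℓ)) where
  field
    cring : CommutativeRing c ℓ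
  open CommutativeRing cring public
  ofℕ′ : ℕ → Carrier
  ofℕ′ = ofℕ cring
  field
    _⁻¹      : Carrier → Carrier
    inverseʳ : ∀ x → ¬ (x ≈ 0#) → x * (x ⁻¹) ≈ 1#
    charZero : ∀ n → ¬ (ofℕ′ (suc n) ≈ 0#)

module Umbral {c ℓ : Level} (F : Field c ℓ) where
  open Field F using (Carrier; _≈_; _+_; _*_; -_; 0#; 1#; _⁻¹; ofℕ′)

  sumTo : (ℕ → Carrier) → ℕ → Carrier
  sumTo f zero    = f zero
  sumTo f (suc n) = sumTo f n + f (suc n)

  -- An umbra, given by its moments E[α^n]; E[α^0] = E[1] = 1.
  record Umbra : Set (c ⊔ ℓ) where
    field
      mom   : ℕ → Carrier
      mom-0 : mom 0 ≈ 1#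
  open Umbra public

  -- formal power series as coefficient sequences
  Series : Set c
  Series = ℕ → Carrier

  oneS : Series
  oneS zero    = 1#
  oneS (suc n) = 0#

  mulS : Series → Series → Series
  mulS f g n = sumTo (λ j → f j * g (n ∸ j)) n

  powS : Series → ℕ → Series
  powS f zero    = oneS
  powS f (suc k) = mulS f (powS f k)

  -- reciprocal of a series with constant term 1:  1/(1+h) = Σ_j (-h)^j
  invS : Series → Series
  invS f n = sumTo (λ j → powS negh j n) n
    where
    negh : Series
    negh zero    = 0#
    negh (suc i) = - f (suc i)

  -- integer powers f^x (for constant term 1)
  zpowS : Series → ℤ → Series
  zpowS f (+ k)      = powS f k
  zpowS f -[1+ k ]   = powS (invS f) (suc k)

  egf : Umbra → Series
  egf α n = mom α n * (ofℕ′ (n !) ⁻¹)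

  -- moments of x.α :  E[(x.α)^n] = n! [t^n] f_α(t)^x
  dotMom : ℤ → Umbra → ℕ → Carrier
  dotMom x α n = ofℕ′ (n !) * zpowS (egf α) x n

  -- moments of γ + k.α with γ and k.α uncorrelated:
  -- E[(γ + k.α)^N] = Σ_j C(N,j) E[γ^j] E[(k.α)^(N-j)]
  sumDotMom : Umbra → ℤ → Umbra → ℕ → Carrier
  sumDotMom γ x α N =
    sumTo (λ j → ofℕ′ (N C j) * (mom γ j * dotMom x α (N ∸ j))) N

  -- ω-Riordan array entry (for n ≥ k):
  -- E[ (c_n / c_k) (γ + k.α)^(n-k) / (n-k)! ]
  riordan : (ℕ → Carrier) → Umbra → Umbra → ℕ → ℕ → Carrier
  riordan cs γ α n k =
    (cs n * (cs k ⁻¹)) * (sumDotMom γ (+ k) α (n ∸ k) * (ofℕ′ ((n ∸ k) !) ⁻¹))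

module Submission where

-- The proof works with exponential generating functions.  Writing
-- f = f_α and g = f_γ, the moments of γ + k.α are the coefficients of
-- g·f^k, so the array entry is
--     R(n,k) = (c_n / c_k) [t^(n-k)] (g·f^k).                     (1)
-- For an integer m ≤ k we have f^k = f^m · f^(k-m), where for m < 0 the
-- factor f^m is a power of the reciprocal series 1/f.  Expanding the
-- coefficient of the product g·f^k = f^m · (g·f^(k-m)) as a Cauchy
-- convolution, and reading each coefficient of g·f^(k-m) back through (1)
-- with index n - m - i and column k - m, gives the claimed sum; the
-- constants c_(n-m-i) and c_(k-m) cancel since all c_j are nonzero.

open import Defs
open import Level using (Level)
open import Data.Nat as ℕ
  using (ℕ; zero; suc; _≤_; _<_; _≤′_; ≤′-refl; ≤′-step; _∸_; _!; z≤n; s≤s)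
import Data.Nat.Properties as ℕP
open import Data.Nat.Combinatorics using (_C_; nCk≡n!/k![n-k]!; k![n∸k]!∣n!)
open import Data.Nat.DivMod using (m/n*n≡m)
open import Data.Integer as ℤ using (ℤ; +_; -[1+_]; ∣_∣)
  renaming (_-_ to _-ℤ_; _≤_ to _≤ℤ_)
import Data.Integer.Properties as ℤP
open import Data.Integer.Tactic.RingSolver using (solve-∀)
open import Relation.Binary.PropositionalEquality as ≡ using (_≡_)
open import Relation.Nullary using (¬_)
import Algebra.Properties.CommutativeSemigroup as CommutativeSemigroupProperties
import Algebra.Properties.Group as GroupProperties
import Algebra.Properties.Semiring.Mult as SemiringMult
import Algebra.Solver.CommutativeMonoid as CommutativeMonoidSolver

binomial-factorials : ∀ N j → j ≤ N → (N C j) ℕ.* (j ! ℕ.* (N ∸ j) !) ≡ N !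
binomial-factorials N j j≤N =
  ≡.trans (≡.cong (ℕ._* (j ! ℕ.* (N ∸ j) !)) (nCk≡n!/k![n-k]! j≤N))
          (m/n*n≡m {{j ℕP.!* (N ∸ j) !≢0}} (k![n∸k]!∣n! j≤N))

+-∸ : ∀ {m n} → n ≤ m → + (m ∸ n) ≡ + m -ℤ + n
+-∸ {m} {n} n≤m = ≡.sym (≡.trans (ℤP.m-n≡m⊖n m n) (ℤP.⊖-≥ n≤m))

shifted-index : ∀ {n k} (m : ℤ) → m ≤ℤ + k → k ≤ n → ∀ i → i ≤ n ∸ k →
  ∣ (+ n -ℤ m) -ℤ + i ∣ ≡ ∣ + k -ℤ m ∣ ℕ.+ (n ∸ k ∸ i)
shifted-index {n} {k} m m≤k k≤n i i≤n-k = ≡.cong ∣_∣ (begin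
    (+ n -ℤ m) -ℤ + i               ≡⟨ regroup (+ n) (+ k) m (+ i) ⟩
    (+ k -ℤ m) ℤ.+ ((+ n -ℤ + k) -ℤ + i)
      ≡⟨ ≡.cong₂ ℤ._+_ (≡.sym (ℤP.0≤i⇒+∣i∣≡i (ℤP.i≤j⇒0≤j-i m≤k))) rest ⟩
    + (∣ + k -ℤ m ∣ ℕ.+ (n ∸ k ∸ i)) ∎)
  where
  open ≡.≡-Reasoning
  regroup : ∀ a b c d → (a -ℤ c) -ℤ d ≡ (b -ℤ c) ℤ.+ ((a -ℤ b) -ℤ d)
  regroup = solve-∀
  rest : (+ n -ℤ + k) -ℤ + i ≡ + (n ∸ k ∸ i)
  rest = ≡.sym (≡.trans (+-∸ i≤n-k) (≡.cong (ℤ._- + i) (+-∸ k≤n)))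

module Development {c ℓ : Level} (F : Field c ℓ) where
  open Field F
  open Umbral F
  open import Relation.Binary.Reasoning.Setoid setoid
  open CommutativeSemigroupProperties +-commutativeSemigroup using (interchange)
  open GroupProperties +-group using (∙-cancelʳ)
  open SemiringMult semiring using (_×_; ×1-homo-*)
  open CommutativeMonoidSolver *-commutativeMonoid using (solve; _⊜_; _⊕_)

  sum-cong : ∀ {f g : ℕ → Carrier} n → (∀ j → j ≤ n → f j ≈ g j) →
             sumTo f n ≈ sumTo g n
  sum-cong zero    f≈g = f≈g 0 z≤n
  sum-cong (suc n) f≈g =
    +-cong (sum-cong n (λ j j≤n → f≈g j (ℕP.m≤n⇒m≤1+n j≤n))) (f≈g (suc n) ℕP.≤-refl)

  sum-zero : ∀ {f : ℕ → Carrier} n → (∀ j → j ≤ n → f j ≈ 0#) → sumTo f n ≈ 0#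
  sum-zero n f≈0 = trans (sum-cong n f≈0) (sum-of-zeros n)
    where
    sum-of-zeros : ∀ n → sumTo (λ _ → 0#) n ≈ 0#
    sum-of-zeros zero    = refl
    sum-of-zeros (suc n) = trans (+-cong (sum-of-zeros n) refl) (+-identityˡ 0#)

  sum-+ : ∀ (f g : ℕ → Carrier) n →
          sumTo (λ j → f j + g j) n ≈ sumTo f n + sumTo g n
  sum-+ f g zero    = refl
  sum-+ f g (suc n) = trans (+-cong (sum-+ f g n) refl) (interchange _ _ _ _)

  sum-*ˡ : ∀ a (f : ℕ → Carrier) n → sumTo (λ j → a * f j) n ≈ a * sumTo f n
  sum-*ˡ a f zero    = refl
  sum-*ˡ a f (suc n) = trans (+-cong (sum-*ˡ a f n) refl) (sym (distribˡ a _ _))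

  sum-*ʳ : ∀ (f : ℕ → Carrier) a n → sumTo (λ j → f j * a) n ≈ sumTo f n * a
  sum-*ʳ f a zero    = refl
  sum-*ʳ f a (suc n) = trans (+-cong (sum-*ʳ f a n) refl) (sym (distribʳ a _ _))

  sum-unshift : ∀ (f : ℕ → Carrier) n →
                sumTo f (suc n) ≈ f 0 + sumTo (λ j → f (suc j)) n
  sum-unshift f zero    = refl
  sum-unshift f (suc n) = trans (+-cong (sum-unshift f n) refl) (+-assoc _ _ _)

  sum-reverse : ∀ (f : ℕ → Carrier) n → sumTo f n ≈ sumTo (λ j → f (n ∸ j)) n
  sum-reverse f zero    = refl
  sum-reverse f (suc n) =
    trans (+-cong (sum-reverse f n) refl)
          (trans (+-comm _ _) (sym (sum-unshift (λ j → f (suc n ∸ j)) n)))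

  sum-truncate : ∀ (f : ℕ → Carrier) {m N} → m ≤′ N →
                 (∀ j → m < j → j ≤ N → f j ≈ 0#) → sumTo f N ≈ sumTo f m
  sum-truncate f ≤′-refl         _   = refl
  sum-truncate f (≤′-step m≤′N) f≈0 =
    trans (+-cong (sum-truncate f m≤′N (λ j m<j j≤N → f≈0 j m<j (ℕP.m≤n⇒m≤1+n j≤N)))
                  (f≈0 _ (s≤s (ℕP.≤′⇒≤ m≤′N)) ℕP.≤-refl))
          (+-identityʳ _)

  sum-exchange : ∀ (G : ℕ → ℕ → Carrier) n →
    sumTo (λ j → sumTo (λ i → G i j) j) n
      ≈ sumTo (λ i → sumTo (λ l → G i (i ℕ.+ l)) (n ∸ i)) n
  sum-exchange G zero    = refl
  sum-exchange G (suc n) = begin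
      sumTo (λ j → sumTo (λ i → G i j) j) n + (sumTo column n + G (suc n) (suc n))
    ≈⟨ +-cong (sum-exchange G n) refl ⟩
      sumTo row n + (sumTo column n + G (suc n) (suc n))
    ≈⟨ sym (+-assoc _ _ _) ⟩
      (sumTo row n + sumTo column n) + G (suc n) (suc n)
    ≈⟨ +-cong (sym (sum-+ row column n)) (reflexive (≡.cong (G (suc n)) (≡.sym (ℕP.+-identityʳ (suc n))))) ⟩
      sumTo (λ i → row i + column i) n + G (suc n) (suc n ℕ.+ 0)
    ≈⟨ +-cong (sum-cong n extend-row)
              (reflexive (≡.cong (sumTo (λ l → G (suc n) (suc n ℕ.+ l))) (≡.sym (ℕP.n∸n≡0 n)))) ⟩
      sumTo (λ i → sumTo (λ l → G i (i ℕ.+ l)) (suc n ∸ i)) (suc n)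
    ∎
    where
    row column : ℕ → Carrier
    row i    = sumTo (λ l → G i (i ℕ.+ l)) (n ∸ i)
    column i = G i (suc n)
    extend-row : ∀ i → i ≤ n → row i + column i ≈ sumTo (λ l → G i (i ℕ.+ l)) (suc n ∸ i)
    extend-row i i≤n =
      trans (+-cong refl (reflexive (≡.cong (G i) (≡.sym last-index))))
            (reflexive (≡.cong (sumTo (λ l → G i (i ℕ.+ l))) (≡.sym (ℕP.+-∸-assoc 1 i≤n))))
      where
      last-index : i ℕ.+ suc (n ∸ i) ≡ suc n
      last-index = ≡.trans (ℕP.+-suc i (n ∸ i)) (≡.cong suc (ℕP.m+[n∸m]≡n i≤n))

  infix 4 _≋_
  _≋_ : Series → Series → Set ℓ
  f ≋ g = ∀ n → f n ≈ g n

  ≋-refl : ∀ {f} → f ≋ f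
  ≋-refl _ = refl

  ≋-sym : ∀ {f g} → f ≋ g → g ≋ f
  ≋-sym f≋g n = sym (f≋g n)

  ≋-trans : ∀ {f g h} → f ≋ g → g ≋ h → f ≋ h
  ≋-trans f≋g g≋h n = trans (f≋g n) (g≋h n)

  mulS-cong : ∀ {f f′ g g′} → f ≋ f′ → g ≋ g′ → mulS f g ≋ mulS f′ g′
  mulS-cong f≋f′ g≋g′ n = sum-cong n (λ j _ → *-cong (f≋f′ j) (g≋g′ (n ∸ j)))

  mulS-congˡ : ∀ {f f′} → f ≋ f′ → ∀ g → mulS f g ≋ mulS f′ g
  mulS-congˡ f≋f′ g = mulS-cong f≋f′ (≋-refl {g})

  mulS-congʳ : ∀ f {g g′} → g ≋ g′ → mulS f g ≋ mulS f g′
  mulS-congʳ f g≋g′ = mulS-cong (≋-refl {f}) g≋g′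

  mulS-comm : ∀ f g → mulS f g ≋ mulS g f
  mulS-comm f g n =
    trans (sum-reverse (λ j → f j * g (n ∸ j)) n)
          (sum-cong n (λ j j≤n → trans (*-comm _ _)
            (reflexive (≡.cong (λ t → g t * f (n ∸ j)) (ℕP.m∸[m∸n]≡n j≤n)))))

  mulS-assoc : ∀ f g h → mulS (mulS f g) h ≋ mulS f (mulS g h)
  mulS-assoc f g h n = begin
      sumTo (λ j → sumTo (λ i → f i * g (j ∸ i)) j * h (n ∸ j)) n
    ≈⟨ sum-cong n (λ j _ → sym (sum-*ʳ _ _ j)) ⟩
      sumTo (λ j → sumTo (λ i → f i * g (j ∸ i) * h (n ∸ j)) j) n
    ≈⟨ sum-exchange (λ i j → f i * g (j ∸ i) * h (n ∸ j)) n ⟩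
      sumTo (λ i → sumTo (λ l → f i * g (i ℕ.+ l ∸ i) * h (n ∸ (i ℕ.+ l))) (n ∸ i)) n
    ≈⟨ sum-cong n (λ i _ → trans (sum-cong (n ∸ i) (λ l _ → reindex i l)) (sum-*ˡ _ _ (n ∸ i))) ⟩
      sumTo (λ i → f i * sumTo (λ l → g l * h (n ∸ i ∸ l)) (n ∸ i)) n
    ∎
    where
    reindex : ∀ i l → f i * g (i ℕ.+ l ∸ i) * h (n ∸ (i ℕ.+ l)) ≈ f i * (g l * h (n ∸ i ∸ l))
    reindex i l = trans (*-assoc _ _ _)
      (*-cong refl (*-cong (reflexive (≡.cong g (ℕP.m+n∸m≡n i l)))
                           (reflexive (≡.cong h (≡.sym (ℕP.∸-+-assoc n i l))))))

  mulS-identityˡ : ∀ g → mulS oneS g ≋ g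
  mulS-identityˡ g zero    = *-identityˡ _
  mulS-identityˡ g (suc n) =
    trans (sum-unshift _ n)
          (trans (+-cong (*-identityˡ _) (sum-zero n (λ _ _ → zeroˡ _))) (+-identityʳ _))

  mulS-distribˡ : ∀ f g h → mulS f (λ i → g i + h i) ≋ (λ n → mulS f g n + mulS f h n)
  mulS-distribˡ f g h n = trans (sum-cong n (λ _ _ → distribˡ _ _ _)) (sum-+ _ _ n)

  mulS-distribʳ : ∀ f g h → mulS (λ i → f i + g i) h ≋ (λ n → mulS f h n + mulS g h n)
  mulS-distribʳ f g h n = trans (sum-cong n (λ _ _ → distribʳ _ _ _)) (sum-+ _ _ n)

  mulS-left-comm : ∀ f g h → mulS f (mulS g h) ≋ mulS g (mulS f h)
  mulS-left-comm f g h =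
    ≋-trans (≋-sym (mulS-assoc f g h))
            (≋-trans (mulS-congˡ (mulS-comm f g) h) (mulS-assoc g f h))

  powS-cong : ∀ {f g} → f ≋ g → ∀ j → powS f j ≋ powS g j
  powS-cong f≋g zero    = ≋-refl
  powS-cong f≋g (suc j) = mulS-cong f≋g (powS-cong f≋g j)

  powS-+ : ∀ f a b → powS f (a ℕ.+ b) ≋ mulS (powS f a) (powS f b)
  powS-+ f zero    b = ≋-sym (mulS-identityˡ _)
  powS-+ f (suc a) b =
    ≋-trans (mulS-congʳ f (powS-+ f a b)) (≋-sym (mulS-assoc f (powS f a) (powS f b)))

  powS-vanish : ∀ h → h 0 ≈ 0# → ∀ j n → n < j → powS h j n ≈ 0#
  powS-vanish h h₀≈0 (suc j) n (s≤s n≤j) = sum-zero n term≈0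
    where
    term≈0 : ∀ i → i ≤ n → h i * powS h j (n ∸ i) ≈ 0#
    term≈0 zero    _   = trans (*-cong h₀≈0 refl) (zeroˡ _)
    term≈0 (suc i) i≤n = trans (*-cong refl (powS-vanish h h₀≈0 j (n ∸ suc i)
      (ℕP.<-≤-trans (ℕP.∸-monoʳ-< {o = 0} (s≤s z≤n) i≤n) n≤j))) (zeroʳ _)

  -- The series h = 1 - f, which has no constant term when f 0 = 1.
  negTail : Series → Series
  negTail f zero    = 0#
  negTail f (suc i) = - f (suc i)

  invS-unfold : ∀ f n → invS f n ≈ sumTo (λ j → powS (negTail f) j n) n
  invS-unfold f n = sum-cong n (λ j _ → powS-cong (λ { zero → refl ; (suc i) → refl }) j n)

  module Reciprocal (f : Series) (f₀≈1 : f 0 ≈ 1#) where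
    h : Series
    h = negTail f

    geom : ℕ → Series
    geom N t = sumTo (λ j → powS h j t) N

    f+h≋1 : (λ t → f t + h t) ≋ oneS
    f+h≋1 zero    = trans (+-cong f₀≈1 refl) (+-identityʳ _)
    f+h≋1 (suc t) = -‿inverseʳ _

    geom-step : ∀ N t → geom (suc N) t ≈ oneS t + mulS h (geom N) t
    geom-step zero    t = refl
    geom-step (suc N) t = begin
        geom (suc N) t + powS h (suc (suc N)) t
      ≈⟨ +-cong (geom-step N t) refl ⟩
        (oneS t + mulS h (geom N) t) + mulS h (powS h (suc N)) t
      ≈⟨ +-assoc _ _ _ ⟩
        oneS t + (mulS h (geom N) t + mulS h (powS h (suc N)) t)
      ≈⟨ +-cong refl (sym (mulS-distribˡ h (geom N) (powS h (suc N)) t)) ⟩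
        oneS t + mulS h (geom (suc N)) t
      ∎

    f·geom : ∀ N t → mulS f (geom N) t + mulS h (geom N) t ≈ geom N t
    f·geom N t = trans (sym (mulS-distribʳ f h (geom N) t))
                       (trans (mulS-congˡ f+h≋1 (geom N) t) (mulS-identityˡ (geom N) t))

    f·geom-diagonal : ∀ t → mulS f (geom t) t ≈ oneS t
    f·geom-diagonal t = ∙-cancelʳ (mulS h (geom t) t) _ _ (begin
        mulS f (geom t) t + mulS h (geom t) t
      ≈⟨ f·geom t t ⟩
        geom t t
      ≈⟨ sym (+-identityʳ _) ⟩
        geom t t + 0#
      ≈⟨ +-cong refl (sym (powS-vanish h refl (suc t) t ℕP.≤-refl)) ⟩
        geom (suc t) t
      ≈⟨ geom-step t t ⟩
        oneS t + mulS h (geom t) t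
      ∎)

    geom-stable : ∀ N t → t ≤ N → geom N t ≈ geom t t
    geom-stable N t t≤N = sum-truncate (λ j → powS h j t) (ℕP.≤⇒≤′ t≤N)
                                       (λ j t<j _ → powS-vanish h refl j t t<j)

    invS-inverseʳ : mulS f (invS f) ≋ oneS
    invS-inverseʳ t =
      trans (sum-cong t (λ j _ → *-cong refl
              (trans (invS-unfold f (t ∸ j)) (sym (geom-stable t (t ∸ j) (ℕP.m∸n≤m t j))))))
            (f·geom-diagonal t)

    invS-cancel : ∀ b k → mulS (powS (invS f) b) (powS f (b ℕ.+ k)) ≋ powS f k
    invS-cancel zero    k = mulS-identityˡ _
    invS-cancel (suc b) k =
      ≋-trans (mulS-assoc I P (mulS f R))
      (≋-trans (mulS-congʳ I (mulS-left-comm P f R))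
      (≋-trans (≋-sym (mulS-assoc I f (mulS P R)))
      (≋-trans (mulS-congˡ (≋-trans (mulS-comm I f) invS-inverseʳ) (mulS P R))
      (≋-trans (mulS-identityˡ _) (invS-cancel b k)))))
      where
      I = invS f
      P = powS I b
      R = powS f (b ℕ.+ k)

  zpowS-split : ∀ f → f 0 ≈ 1# → ∀ k (m : ℤ) → m ≤ℤ + k →
                mulS (zpowS f m) (powS f ∣ + k -ℤ m ∣) ≋ powS f k
  zpowS-split f f₀≈1 k (+ a) (ℤ.+≤+ a≤k) =
    ≡.subst (λ e → mulS (powS f a) (powS f e) ≋ powS f k) (≡.sym k-a)
      (≋-trans (≋-sym (powS-+ f a (k ∸ a)))
               (λ t → reflexive (≡.cong (λ e → powS f e t) (ℕP.m+[n∸m]≡n a≤k))))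
    where
    k-a : ∣ + k -ℤ + a ∣ ≡ k ∸ a
    k-a = ≡.cong ∣_∣ (≡.sym (+-∸ a≤k))
  zpowS-split f f₀≈1 k -[1+ b ] _ =
    ≡.subst (λ e → mulS (powS (invS f) (suc b)) (powS f e) ≋ powS f k) (ℕP.+-comm (suc b) k)
      (Reciprocal.invS-cancel f f₀≈1 (suc b) k)

  -- The embedding of ℕ is the library's n × 1#, hence multiplicative.
  ofℕ≈×1 : ∀ n → ofℕ′ n ≈ n × 1#
  ofℕ≈×1 zero    = refl
  ofℕ≈×1 (suc n) = +-cong refl (ofℕ≈×1 n)

  ofℕ-* : ∀ a b → ofℕ′ (a ℕ.* b) ≈ ofℕ′ a * ofℕ′ b
  ofℕ-* a b = trans (ofℕ≈×1 (a ℕ.* b))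
    (trans (×1-homo-* a b) (sym (*-cong (ofℕ≈×1 a) (ofℕ≈×1 b))))

  factorial-inverse : ∀ t → ofℕ′ (t !) * (ofℕ′ (t !) ⁻¹) ≈ 1#
  factorial-inverse t = inverseʳ _ (factorial≉0 t (t !) ≡.refl)
    where
    factorial≉0 : ∀ t n → t ! ≡ n → ¬ (ofℕ′ n ≈ 0#)
    factorial≉0 t zero    t!≡0 = λ _ → ℕP.<⇒≢ (ℕP.1≤n! t) (≡.sym t!≡0)
    factorial≉0 t (suc n) _    = charZero n

  cancel-inverse : ∀ x y a b → ¬ (x ≈ 0#) →
                   (x ⁻¹) * (a * ((x * y) * b)) ≈ y * (a * b)
  cancel-inverse x y a b x≉0 =
    trans (solve 5 (λ x y a b x′ → (x′ ⊕ (a ⊕ ((x ⊕ y) ⊕ b))) ⊜ ((x ⊕ x′) ⊕ (y ⊕ (a ⊕ b))))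
                 refl x y a b (x ⁻¹))
          (trans (*-cong (inverseʳ x x≉0) refl) (*-identityˡ _))

  insert-inverse : ∀ x a b y → ¬ (x ≈ 0#) →
                   (a * b) * y ≈ ((a * x) * b) * ((x ⁻¹) * y)
  insert-inverse x a b y x≉0 = sym
    (trans (solve 5 (λ x a b y x′ → (((a ⊕ x) ⊕ b) ⊕ (x′ ⊕ y)) ⊜ ((x ⊕ x′) ⊕ ((a ⊕ b) ⊕ y)))
                 refl x a b y (x ⁻¹))
           (trans (*-cong (inverseʳ x x≉0) refl) (*-identityˡ _)))

  egf-constant : ∀ α → egf α 0 ≈ 1#
  egf-constant α =
    trans (*-cong (trans (mom-0 α) (sym (+-identityʳ 1#))) refl) (factorial-inverse 0)

  dotMom-coefficient : ∀ x α i → dotMom x α i * (ofℕ′ (i !) ⁻¹) ≈ zpowS (egf α) x i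
  dotMom-coefficient x α i =
    trans (solve 3 (λ a z b → ((a ⊕ z) ⊕ b) ⊜ ((a ⊕ b) ⊕ z)) refl _ _ _)
          (trans (*-cong (factorial-inverse i) refl) (*-identityˡ _))

  sumDotMom-coefficient : ∀ γ x α N →
    sumDotMom γ x α N * (ofℕ′ (N !) ⁻¹) ≈ mulS (egf γ) (zpowS (egf α) x) N
  sumDotMom-coefficient γ x α N = trans (sym (sum-*ʳ _ _ N)) (sum-cong N term)
    where
    term : ∀ j → j ≤ N →
      (ofℕ′ (N C j) * (mom γ j * dotMom x α (N ∸ j))) * (ofℕ′ (N !) ⁻¹)
        ≈ egf γ j * zpowS (egf α) x (N ∸ j)
    term j j≤N = begin
        (b * (g * (ofℕ′ ((N ∸ j) !) * z))) * N!⁻¹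
      ≈⟨ sym (trans (*-cong refl (factorial-inverse j)) (*-identityʳ _)) ⟩
        ((b * (g * (ofℕ′ ((N ∸ j) !) * z))) * N!⁻¹) * (ofℕ′ (j !) * j!⁻¹)
      ≈⟨ solve 7 (λ b g r z N′ J J′ →
            (((b ⊕ (g ⊕ (r ⊕ z))) ⊕ N′) ⊕ (J ⊕ J′)) ⊜ (((g ⊕ J′) ⊕ z) ⊕ ((b ⊕ (J ⊕ r)) ⊕ N′)))
            refl b g (ofℕ′ ((N ∸ j) !)) z N!⁻¹ (ofℕ′ (j !)) j!⁻¹ ⟩
        ((g * j!⁻¹) * z) * ((b * (ofℕ′ (j !) * ofℕ′ ((N ∸ j) !))) * N!⁻¹)
      ≈⟨ *-cong refl (*-cong binomial refl) ⟩
        ((g * j!⁻¹) * z) * (ofℕ′ (N !) * N!⁻¹)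
      ≈⟨ trans (*-cong refl (factorial-inverse N)) (*-identityʳ _) ⟩
        (g * j!⁻¹) * z
      ∎
      where
      b = ofℕ′ (N C j)
      g = mom γ j
      z = zpowS (egf α) x (N ∸ j)
      N!⁻¹ = ofℕ′ (N !) ⁻¹
      j!⁻¹ = ofℕ′ (j !) ⁻¹
      binomial : b * (ofℕ′ (j !) * ofℕ′ ((N ∸ j) !)) ≈ ofℕ′ (N !)
      binomial = trans (*-cong refl (sym (ofℕ-* (j !) ((N ∸ j) !))))
                       (trans (sym (ofℕ-* (N C j) _))
                              (reflexive (≡.cong ofℕ′ (binomial-factorials N j j≤N))))

  riordan-coefficient : ∀ cs γ α K d →
    riordan cs γ α (K ℕ.+ d) K
      ≈ (cs (K ℕ.+ d) * (cs K ⁻¹)) * mulS (egf γ) (powS (egf α) K) d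
  riordan-coefficient cs γ α K d = *-cong refl (begin
      sumDotMom γ (+ K) α (K ℕ.+ d ∸ K) * (ofℕ′ ((K ℕ.+ d ∸ K) !) ⁻¹)
    ≈⟨ reflexive (≡.cong (λ e → sumDotMom γ (+ K) α e * (ofℕ′ (e !) ⁻¹)) (ℕP.m+n∸m≡n K d)) ⟩
      sumDotMom γ (+ K) α d * (ofℕ′ (d !) ⁻¹)
    ≈⟨ sumDotMom-coefficient γ (+ K) α d ⟩
      mulS (egf γ) (powS (egf α) K) d
    ∎)

  -- The recurrence for an arbitrary factorisation f_α^k = P · f_α^K:
  -- R(n,k) = (c_n c_K / c_k) Σ_i c_(K+n-k-i)⁻¹ P_i R(K+n-k-i, K).
  riordan-recurrence : ∀ cs → (∀ j → ¬ (cs j ≈ 0#)) → ∀ γ α n k K (P : Series) →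
    k ≤ n → mulS P (powS (egf α) K) ≋ powS (egf α) k →
    riordan cs γ α n k
      ≈ ((cs n * cs K) * (cs k ⁻¹))
        * sumTo (λ i → (cs (K ℕ.+ (n ∸ k ∸ i)) ⁻¹)
                       * (P i * riordan cs γ α (K ℕ.+ (n ∸ k ∸ i)) K))
                (n ∸ k)
  riordan-recurrence cs cs≉0 γ α n k K P k≤n split = begin
      riordan cs γ α n k
    ≈⟨ reflexive (≡.cong (λ e → riordan cs γ α e k) (≡.sym (ℕP.m+[n∸m]≡n k≤n))) ⟩
      riordan cs γ α (k ℕ.+ d) k
    ≈⟨ riordan-coefficient cs γ α k d ⟩
      (cs (k ℕ.+ d) * (cs k ⁻¹)) * Gk d
    ≈⟨ *-cong (*-cong (reflexive (≡.cong cs (ℕP.m+[n∸m]≡n k≤n))) refl) (sym (convolution d)) ⟩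
      (cs n * (cs k ⁻¹)) * mulS P GK d
    ≈⟨ insert-inverse (cs K) (cs n) (cs k ⁻¹) (mulS P GK d) (cs≉0 K) ⟩
      ((cs n * cs K) * (cs k ⁻¹)) * ((cs K ⁻¹) * mulS P GK d)
    ≈⟨ *-cong refl (sym (trans (sum-cong d summand) (sum-*ˡ _ _ d))) ⟩
      ((cs n * cs K) * (cs k ⁻¹))
        * sumTo (λ i → (cs (K ℕ.+ (d ∸ i)) ⁻¹) * (P i * riordan cs γ α (K ℕ.+ (d ∸ i)) K)) d
    ∎
    where
    d = n ∸ k
    GK = mulS (egf γ) (powS (egf α) K)
    Gk = mulS (egf γ) (powS (egf α) k)
    convolution : mulS P GK ≋ Gk
    convolution = ≋-trans (mulS-left-comm P (egf γ) (powS (egf α) K))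
                          (mulS-congʳ (egf γ) split)
    summand : ∀ i → i ≤ d →
      (cs (K ℕ.+ (d ∸ i)) ⁻¹) * (P i * riordan cs γ α (K ℕ.+ (d ∸ i)) K)
        ≈ (cs K ⁻¹) * (P i * GK (d ∸ i))
    summand i _ =
      trans (*-cong refl (*-cong refl (riordan-coefficient cs γ α K (d ∸ i))))
            (cancel-inverse (cs (K ℕ.+ (d ∸ i))) (cs K ⁻¹) (P i) (GK (d ∸ i)) (cs≉0 _))

theorem3p17 : ∀ {c ℓ : Level} (F : Field c ℓ) →
  let open Field F
      open Umbral F
  in (cs : ℕ → Carrier) → (∀ n → ¬ (cs n ≈ 0#)) → cs 0 ≈ 1# →
     (ω : Umbra) → (∀ n → mom ω n ≈ ofℕ′ (n !) * (cs n ⁻¹)) →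
     (γ α : Umbra) → (n k : ℕ) → k ≤ n → (m : ℤ) → m ≤ℤ + k →
     riordan cs γ α n k
       ≈ ((cs n * cs ∣ + k -ℤ m ∣) * (cs k ⁻¹))
         * sumTo (λ i → (cs ∣ (+ n -ℤ m) -ℤ + i ∣ ⁻¹)
                        * ((dotMom m α i * (ofℕ′ (i !) ⁻¹))
                           * riordan cs γ α ∣ (+ n -ℤ m) -ℤ + i ∣ ∣ + k -ℤ m ∣))
                 (n ∸ k)
theorem3p17 F cs cs≉0 _ _ _ γ α n k k≤n m m≤k =
  trans (riordan-recurrence cs cs≉0 γ α n k K (zpowS (egf α) m) k≤n
           (zpowS-split (egf α) (egf-constant α) k m m≤k))
        (*-cong refl (sum-cong (n ∸ k) summand))
  where
  open Field F
  open Umbral F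
  open Development F
  K = ∣ + k -ℤ m ∣
  -- Each summand: the row index K + (n-k-i) is n - m - i, and the
  -- coefficient of f_α^m is the moment of m.α divided by i!.
  summand : ∀ i → i ≤ n ∸ k →
    (cs (K ℕ.+ (n ∸ k ∸ i)) ⁻¹) * (zpowS (egf α) m i * riordan cs γ α (K ℕ.+ (n ∸ k ∸ i)) K)
      ≈ (cs ∣ (+ n -ℤ m) -ℤ + i ∣ ⁻¹)
        * ((dotMom m α i * (ofℕ′ (i !) ⁻¹)) * riordan cs γ α ∣ (+ n -ℤ m) -ℤ + i ∣ K)
  summand i i≤n-k =
    trans (*-cong refl (*-cong (sym (dotMom-coefficient m α i)) refl))
          (reflexive (≡.cong (λ e → (cs e ⁻¹) * ((dotMom m α i * (ofℕ′ (i !) ⁻¹)) * riordan cs γ α e K))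
                             (≡.sym (shifted-index m m≤k k≤n i i≤n-k))))
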